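{- Let $T$ be a bidirected tree rooted at some vertex, and let $r^-$, $r^+$, $r^\vee$ be a converging, a diverging and a unimodal request in $T$, respectively. Then two of the requests in $\{r^-,r^+,r^\vee\}$ interfere.
   Context: A bidirected tree $T$ is a digraph obtained from a finite undirected tree by replacing each edge $uv$ by the two arcs $(u,v)$ and $(v,u)$. A request in $T$ is a directed path in $T$ with at least one arc. For a directed path $r$, $s_r$ is its first vertex, $t_r$ its last vertex, $s_r^+$ its second vertex, $t_r^-$ its penultimate vertex; its emission arc is $(s_r,s_r^+)$ and its reception arc is $(t_r^-,t_r)$. $T[x,y]$ denotes the unique directed path from $x$ to $y$ in $T$. A request $r$ interferes on $r'$ if $T[s_r,t_{r'}]$ has first arc the emission arc of $r$ and last arc the reception arc of $r'$; two requests interfere if one interferes on the other. When $T$ is rooted at $z$, an arc is converging if directed towards $z$ and diverging otherwise; a directed path is converging (resp. diverging) if all its arcs are converging (resp. diverging), and unimodal otherwise. -}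

module Defs where

open import Data.Nat using (ℕ)
open import Data.Fin using (Fin)
open import Data.Bool using (Bool; true; false)
open import Data.List using (List; []; _∷_)
open import Data.List.Relation.Unary.All using (All)
open import Data.List.Relation.Unary.Linked using (Linked)
open import Data.List.Relation.Unary.Unique.Propositional using (Unique)
open import Data.Product using (Σ; _×_; _,_; ∃)
open import Data.Sum using (_⊎_)
open import Data.Empty using (⊥)
open import Relation.Nullary using (¬_)
open import Relation.Binary.PropositionalEquality using (_≡_)

-- A finite simple undirected graph on vertex set Fin n, given by a Boolean
-- adjacency function.  Its bidirected version has an arc (u,v) for every
-- edge uv, i.e. iff E u v ≡ true.
Graph : ℕ → Set
Graph n = Fin n → Fin n → Bool

module _ {n : ℕ} (E : Graph n) where

  Arc : Fin n → Fin n → Set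
  Arc u v = E u v ≡ true

  IsPath : List (Fin n) → Set
  IsPath xs = Linked Arc xs × Unique xs

  lastV : Fin n → List (Fin n) → Fin n
  lastV a []       = a
  lastV a (b ∷ bs) = lastV b bs

  lastTwo : Fin n → Fin n → List (Fin n) → Fin n × Fin n
  lastTwo a b []       = a , b
  lastTwo a b (c ∷ cs) = lastTwo b c cs

  arcs : List (Fin n) → List (Fin n × Fin n)
  arcs []           = []
  arcs (a ∷ [])     = []
  arcs (a ∷ b ∷ cs) = (a , b) ∷ arcs (b ∷ cs)

  record IsTree : Set where
    field
      sym        : ∀ u v → E u v ≡ E v u
      irrefl     : ∀ v → E v v ≡ false
      connected  : ∀ x y → ∃ λ ys → IsPath (x ∷ ys) × lastV x ys ≡ y
      acyclic    : ∀ a b c rest → IsPath (a ∷ b ∷ c ∷ rest) →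
                   Arc (lastV c rest) a → ⊥

  -- A request: a directed path with at least one arc,
  -- vertex list src ∷ snd ∷ rest (s_r = src, s_r^+ = snd).
  record Request : Set where
    field
      src    : Fin n
      snd    : Fin n
      rest   : List (Fin n)
      isPath : IsPath (src ∷ snd ∷ rest)

    verts : List (Fin n)
    verts = src ∷ snd ∷ rest

    pen : Fin n
    pen = Data.Product.proj₁ (lastTwo src snd rest)

    tgt : Fin n
    tgt = Data.Product.proj₂ (lastTwo src snd rest)

  open Request public

  -- T[x,y] (unique in a tree) has first arc (x,x⁺) and last arc (y⁻,y):
  -- there is a path x ∷ x⁺ ∷ ys whose last two vertices are y⁻ , y.
  -- r interferes on r'
  InterferesOn : Request → Request → Set
  InterferesOn r r' =
    ∃ λ ys → IsPath (src r ∷ snd r ∷ ys) ×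
             lastTwo (src r) (snd r) ys ≡ (pen r' , tgt r')

  Interfere : Request → Request → Set
  Interfere r r' = InterferesOn r r' ⊎ InterferesOn r' r

  -- With T rooted at z: arc (u,v) is converging iff it is directed towards z,
  -- i.e. the path from u to z starts with the arc (u,v).
  ConvergingArc : Fin n → Fin n → Fin n → Set
  ConvergingArc z u v = ∃ λ ys → IsPath (u ∷ v ∷ ys) × lastV v ys ≡ z

  DivergingArc : Fin n → Fin n → Fin n → Set
  DivergingArc z u v = ¬ ConvergingArc z u v

  ConvergingReq : Fin n → Request → Set
  ConvergingReq z r = All (λ p → ConvergingArc z (Data.Product.proj₁ p) (Data.Product.proj₂ p)) (arcs (verts r))

  DivergingReq : Fin n → Request → Set
  DivergingReq z r = All (λ p → DivergingArc z (Data.Product.proj₁ p) (Data.Product.proj₂ p)) (arcs (verts r))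

  UnimodalReq : Fin n → Request → Set
  UnimodalReq z r = ¬ ConvergingReq z r × ¬ DivergingReq z r

-- Root T at z and let y ≼ x mean that y lies on the path from x to z.  Every arc joins
-- a vertex to its parent, and a path never goes down and then up, so T[s,t] climbs from s
-- and then descends to t: its first arc leaves s upwards iff s is not an ancestor of t,
-- and its last arc enters t from above iff t is not an ancestor of s.  Hence r⁻ climbs,
-- r⁺ descends, and r∨ climbs then descends with ≼-incomparable endpoints.  Each of the
-- five ways in which two of the requests can interfere becomes a comparability condition
-- on s⁻, t⁺, s∨, t∨, and since the ancestors of any vertex form a chain, one of the five
-- conditions always holds.
module Submission where

open import Defs
open import Data.Nat using (ℕ; suc; _+_)
open import Data.Nat.Properties using (m≢1+n+m; +-suc)
open import Data.Fin using (Fin; _≟_)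
open import Data.List using (List; []; _∷_; _++_; [_]; length)
open import Data.List.Properties
  using (∷-injectiveˡ; ∷-injectiveʳ; ++-cancelʳ; ++-assoc; ∷ʳ-injective; ≡-dec; length-++)
open import Data.List.Relation.Unary.All as All using (All; []; _∷_)
open import Data.List.Relation.Unary.All.Properties using (All¬⇒¬Any; ¬Any⇒All¬; ++⁻ˡ)
open import Data.List.Relation.Unary.Any using (here; there)
open import Data.List.Relation.Unary.AllPairs using (AllPairs; []; _∷_)
open import Data.List.Relation.Unary.Linked using (Linked; []; [-]; _∷_)
open import Data.List.Relation.Unary.Unique.Propositional using (Unique)
open import Data.List.Membership.Propositional using (_∈_; _∉_)
open import Data.List.Membership.Propositional.Properties using (∈-∃++; ∈-++⁺ʳ)
open import Data.Product using (_×_; _,_; ∃; ∃₂; proj₁; proj₂)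
open import Data.Sum using (_⊎_; inj₁; inj₂)
open import Data.Empty using (⊥; ⊥-elim)
open import Function using (_∘_; case_of_)
open import Relation.Nullary using (¬_; yes; no; Dec)
open import Relation.Nullary.Decidable using (_⊎-dec_)
open import Relation.Binary.Definitions using (Decidable)
open import Relation.Binary.PropositionalEquality hiding ([_])

module _ {A : Set} where

  Linked-++⁻ˡ : ∀ {R : A → A → Set} xs {ys} → Linked R (xs ++ ys) → Linked R xs
  Linked-++⁻ˡ []           _        = []
  Linked-++⁻ˡ (x ∷ [])     _        = [-]
  Linked-++⁻ˡ (x ∷ y ∷ xs) (r ∷ rs) = r ∷ Linked-++⁻ˡ (y ∷ xs) rs

  Linked-++⁻ʳ : ∀ {R : A → A → Set} xs {ys} → Linked R (xs ++ ys) → Linked R ys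
  Linked-++⁻ʳ []           rs       = rs
  Linked-++⁻ʳ (x ∷ [])     [-]      = []
  Linked-++⁻ʳ (x ∷ [])     (_ ∷ rs) = rs
  Linked-++⁻ʳ (x ∷ y ∷ xs) (_ ∷ rs) = Linked-++⁻ʳ (y ∷ xs) rs

  AllPairs-++⁻ˡ : ∀ {R : A → A → Set} xs {ys} → AllPairs R (xs ++ ys) → AllPairs R xs
  AllPairs-++⁻ˡ []       _        = []
  AllPairs-++⁻ˡ (x ∷ xs) (p ∷ ps) = ++⁻ˡ xs p ∷ AllPairs-++⁻ˡ xs ps

  AllPairs-++⁻ʳ : ∀ {R : A → A → Set} xs {ys} → AllPairs R (xs ++ ys) → AllPairs R ys
  AllPairs-++⁻ʳ []       ps       = ps
  AllPairs-++⁻ʳ (x ∷ xs) (_ ∷ ps) = AllPairs-++⁻ʳ xs ps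

  Unique-head-∉ : ∀ {x : A} {xs} → Unique (x ∷ xs) → x ∉ xs
  Unique-head-∉ (x∉xs ∷ _) = All¬⇒¬Any x∉xs

  ++-∷-≢ : ∀ xs ys {y : A} → xs ≢ ys ++ y ∷ xs
  ++-∷-≢ xs ys eq = m≢1+n+m (length xs) (begin
    length xs                       ≡⟨ cong length eq ⟩
    length (ys ++ _ ∷ xs)           ≡⟨ length-++ ys ⟩
    length ys + suc (length xs)     ≡⟨ +-suc (length ys) (length xs) ⟩
    suc (length ys + length xs)     ∎)
    where open ≡-Reasoning

  ++-∷-cancelʳ : ∀ xs ys {x y : A} zs → xs ++ x ∷ zs ≡ ys ++ y ∷ zs → x ≡ y
  ++-∷-cancelʳ xs ys {x} {y} zs eq =
    proj₂ (∷ʳ-injective xs ys (++-cancelʳ zs (xs ++ [ x ]) (ys ++ [ y ]) (begin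
      (xs ++ [ x ]) ++ zs   ≡⟨ ++-assoc xs [ x ] zs ⟩
      xs ++ x ∷ zs          ≡⟨ eq ⟩
      ys ++ y ∷ zs          ≡⟨ ++-assoc ys [ y ] zs ⟨
      (ys ++ [ y ]) ++ zs   ∎)))
    where open ≡-Reasoning

  ++-suffix-total : ∀ xs ys {us vs : List A} → xs ++ us ≡ ys ++ vs →
                    (∃ λ ws → us ≡ ws ++ vs) ⊎ (∃ λ ws → vs ≡ ws ++ us)
  ++-suffix-total []       ys       eq = inj₁ (ys , eq)
  ++-suffix-total (x ∷ xs) []       eq = inj₂ (x ∷ xs , sym eq)
  ++-suffix-total (x ∷ xs) (y ∷ ys) eq = ++-suffix-total xs ys (∷-injectiveʳ eq)

module TreeOrder {A : Set} (_≼_ : A → A → Set)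
    (≼-trans : ∀ {x y w} → x ≼ y → y ≼ w → x ≼ w)
    (≼-chain : ∀ {x y w} → y ≼ x → w ≼ x → y ≼ w ⊎ w ≼ y)
    (_≼?_ : Decidable _≼_) where

  Comparable : A → A → Set
  Comparable x y = x ≼ y ⊎ y ≼ x

  comparable? : ∀ x y → Dec (Comparable x y)
  comparable? x y = (x ≼? y) ⊎-dec (y ≼? x)

  comparable-config-⊥ : ∀ {a b x y} → ¬ Comparable a b → Comparable x b → Comparable x y →
                        Comparable a y → ¬ x ≼ a → ¬ y ≼ b → ⊥
  comparable-config-⊥ a∥b (inj₁ x≼b) (inj₁ x≼y) (inj₁ a≼y) x⋠a _ with ≼-chain a≼y x≼y
  ... | inj₁ a≼x = a∥b (inj₁ (≼-trans a≼x x≼b))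
  ... | inj₂ x≼a = x⋠a x≼a
  comparable-config-⊥ _ (inj₁ _) (inj₁ x≼y) (inj₂ y≼a) x⋠a _ = x⋠a (≼-trans x≼y y≼a)
  comparable-config-⊥ _ (inj₁ x≼b) (inj₂ y≼x) _ _ y⋠b = y⋠b (≼-trans y≼x x≼b)
  comparable-config-⊥ a∥b (inj₂ b≼x) (inj₁ x≼y) (inj₁ a≼y) _ _ = a∥b (≼-chain a≼y (≼-trans b≼x x≼y))
  comparable-config-⊥ a∥b (inj₂ b≼x) (inj₁ x≼y) (inj₂ y≼a) _ _ =
    a∥b (inj₂ (≼-trans b≼x (≼-trans x≼y y≼a)))
  comparable-config-⊥ a∥b (inj₂ b≼x) (inj₂ y≼x) ay _ y⋠b with ≼-chain b≼x y≼x | ay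
  ... | inj₁ b≼y | inj₁ a≼y = a∥b (≼-chain a≼y b≼y)
  ... | inj₁ b≼y | inj₂ y≼a = a∥b (inj₂ (≼-trans b≼y y≼a))
  ... | inj₂ y≼b | _        = y⋠b y≼b

  -- With a , b , x , y the endpoints s∨ , t∨ , s⁻ , t⁺, each alternative makes two of the
  -- three requests interfere.
  ∥-split : ∀ {a b} → ¬ Comparable a b → ∀ x y →
            ¬ Comparable x b ⊎ ¬ Comparable x y ⊎ ¬ Comparable a y ⊎ x ≼ a ⊎ y ≼ b
  ∥-split {a} {b} a∥b x y with x ≼? a | y ≼? b | comparable? x b | comparable? x y | comparable? a y
  ... | yes x≼a | _       | _       | _       | _       = inj₂ (inj₂ (inj₂ (inj₁ x≼a)))
  ... | no _    | yes y≼b | _       | _       | _       = inj₂ (inj₂ (inj₂ (inj₂ y≼b)))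
  ... | no _    | no _    | no x∥b  | _       | _       = inj₁ x∥b
  ... | no _    | no _    | yes _   | no x∥y  | _       = inj₂ (inj₁ x∥y)
  ... | no _    | no _    | yes _   | yes _   | no a∥y  = inj₂ (inj₂ (inj₁ a∥y))
  ... | no x⋠a  | no y⋠b  | yes xb  | yes xy  | yes ay  =
    ⊥-elim (comparable-config-⊥ a∥b xb xy ay x⋠a y⋠b)

module Paths {n : ℕ} (E : Graph n) where

  penult ult : Fin n → Fin n → List (Fin n) → Fin n
  penult a b xs = proj₁ (lastTwo E a b xs)
  ult    a b xs = proj₂ (lastTwo E a b xs)

  lastV-∈ : ∀ a xs → lastV E a xs ∈ a ∷ xs
  lastV-∈ a []       = here refl
  lastV-∈ a (b ∷ xs) = there (lastV-∈ b xs)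

  lastV-++ : ∀ a xs b ys → lastV E a (xs ++ b ∷ ys) ≡ lastV E b ys
  lastV-++ a []       b ys = refl
  lastV-++ a (c ∷ xs) b ys = lastV-++ c xs b ys

  lastV-split : ∀ {a xs} ys b zs → a ∷ xs ≡ ys ++ b ∷ zs → lastV E a xs ≡ lastV E b zs
  lastV-split []       b zs refl = refl
  lastV-split (c ∷ ys) b zs refl = lastV-++ c ys b zs

  ult≡lastV : ∀ a b xs → ult a b xs ≡ lastV E b xs
  ult≡lastV a b []       = refl
  ult≡lastV a b (c ∷ xs) = ult≡lastV b c xs

  All-arcs-last : ∀ {P : Fin n × Fin n → Set} a b xs →
                  All P (arcs E (a ∷ b ∷ xs)) → P (lastTwo E a b xs)
  All-arcs-last a b []       (p ∷ []) = p
  All-arcs-last a b (c ∷ xs) (_ ∷ ps) = All-arcs-last b c xs ps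

  IsPath-++⁻ˡ : ∀ xs {ys} → IsPath E (xs ++ ys) → IsPath E xs
  IsPath-++⁻ˡ xs (l , u) = Linked-++⁻ˡ xs l , AllPairs-++⁻ˡ xs u

  IsPath-++⁻ʳ : ∀ xs {ys} → IsPath E (xs ++ ys) → IsPath E ys
  IsPath-++⁻ʳ xs (l , u) = Linked-++⁻ʳ xs l , AllPairs-++⁻ʳ xs u

  IsPath-tail : ∀ {a xs} → IsPath E (a ∷ xs) → IsPath E xs
  IsPath-tail {a} = IsPath-++⁻ʳ [ a ]

  IsPath-head-∉ : ∀ {a xs} → IsPath E (a ∷ xs) → a ∉ xs
  IsPath-head-∉ (_ , u) = Unique-head-∉ u

  firstArc : ∀ {a b xs} → IsPath E (a ∷ b ∷ xs) → Arc E a b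
  firstArc (ab ∷ _ , _) = ab

  lastArc : ∀ {a b} xs → IsPath E (a ∷ b ∷ xs) → Arc E (penult a b xs) (ult a b xs)
  lastArc []       p = firstArc p
  lastArc (c ∷ xs) p = lastArc xs (IsPath-tail p)

  ∈-∃-prefix : ∀ {v c} xs → v ∈ c ∷ xs → ∃₂ λ ys zs → xs ≡ ys ++ zs × lastV E c ys ≡ v
  ∈-∃-prefix xs       (here refl) = [] , xs , refl , refl
  ∈-∃-prefix (d ∷ xs) (there v∈)  with ∈-∃-prefix xs v∈
  ... | ys , zs , eq , last = d ∷ ys , zs , cong (d ∷_) eq , last

module Tree {n : ℕ} {E : Graph n} (tree : IsTree E) where

  open Paths E
  open import Data.List.Membership.DecPropositional (_≟_ {n}) using (_∈?_)

  open IsTree tree renaming (sym to E-sym)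

  arc-sym : ∀ {u v} → Arc E u v → Arc E v u
  arc-sym {u} {v} uv = trans (E-sym v u) uv

  arc-irrefl : ∀ {v} → ¬ Arc E v v
  arc-irrefl {v} vv with trans (sym vv) (irrefl v)
  ... | ()

  no-arc-back : ∀ {a b v} xs → IsPath E (a ∷ b ∷ xs) → v ∈ xs → ¬ Arc E v a
  no-arc-back {a} {b} (c ∷ xs) p v∈ va with ∈-∃-prefix xs v∈
  ... | ys , zs , refl , refl = acyclic a b c ys (IsPath-++⁻ˡ (a ∷ b ∷ c ∷ ys) p) va

  path-unique : ∀ x xs ys → IsPath E (x ∷ xs) → IsPath E (x ∷ ys) →
                lastV E x xs ≡ lastV E x ys → xs ≡ ys
  path-unique x []       []       _ _ _ = refl
  path-unique x []       (b ∷ ys) _ q e =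
    ⊥-elim (IsPath-head-∉ q (subst (_∈ b ∷ ys) (sym e) (lastV-∈ b ys)))
  path-unique x (a ∷ xs) []       p _ e =
    ⊥-elim (IsPath-head-∉ p (subst (_∈ a ∷ xs) e (lastV-∈ a xs)))
  path-unique x (a ∷ xs) (b ∷ ys) p q e with a ≟ b | b ∈? xs
  ... | yes refl | _        = cong (a ∷_) (path-unique a xs ys (IsPath-tail p) (IsPath-tail q) e)
  ... | no _     | yes b∈xs = ⊥-elim (no-arc-back xs p b∈xs (arc-sym (firstArc q)))
  ... | no a≢b   | no b∉xs  =
    ⊥-elim (IsPath-head-∉ q (there (subst (x ∈_) tail≡ (here refl))))
    where
      b∉ : All (b ≢_) (x ∷ a ∷ xs)
      b∉ = (λ b≡x → IsPath-head-∉ q (here (sym b≡x))) ∷ (λ b≡a → a≢b (sym b≡a)) ∷ ¬Any⇒All¬ xs b∉xs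
      detour : IsPath E (b ∷ x ∷ a ∷ xs)
      detour = arc-sym (firstArc q) ∷ proj₁ p , b∉ ∷ proj₂ p
      tail≡ : x ∷ a ∷ xs ≡ ys
      tail≡ = path-unique b (x ∷ a ∷ xs) ys detour (IsPath-tail q) e

module Rooted {n : ℕ} {E : Graph n} (tree : IsTree E) (z : Fin n) where

  open Paths E
  open Tree tree
  open IsTree tree using (connected)
  open import Data.List.Membership.DecPropositional (_≟_ {n}) using (_∈?_)

  rootTail : Fin n → List (Fin n)
  rootTail x = proj₁ (connected x z)

  rootPath : Fin n → List (Fin n)
  rootPath x = x ∷ rootTail x

  rootPath-isPath : ∀ x → IsPath E (rootPath x)
  rootPath-isPath x = proj₁ (proj₂ (connected x z))

  rootPath-last : ∀ x → lastV E x (rootTail x) ≡ z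
  rootPath-last x = proj₂ (proj₂ (connected x z))

  rootTail-unique : ∀ {x} ys → IsPath E (x ∷ ys) → lastV E x ys ≡ z → ys ≡ rootTail x
  rootTail-unique {x} ys p e =
    path-unique x ys (rootTail x) p (rootPath-isPath x) (trans e (sym (rootPath-last x)))

  infix 4 _≼_ _≼?_

  _≼_ : Fin n → Fin n → Set
  y ≼ x = y ∈ rootPath x

  _≼?_ : Decidable _≼_
  y ≼? x = y ∈? rootPath x

  Parent : Fin n → Fin n → Set
  Parent p c = rootTail c ≡ rootPath p

  parent-unique : ∀ {p q c} → Parent p c → Parent q c → p ≡ q
  parent-unique p↓c q↓c = ∷-injectiveˡ (trans (sym p↓c) q↓c)

  parent-≼ : ∀ {p c} → Parent p c → p ≼ c
  parent-≼ p↓c = there (subst (_ ∈_) (sym p↓c) (here refl))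

  ≼-of-child : ∀ {p c w} → Parent p c → w ≼ c → w ≡ c ⊎ w ≼ p
  ≼-of-child _   (here w≡c) = inj₁ w≡c
  ≼-of-child p↓c (there w∈) = inj₂ (subst (_ ∈_) p↓c w∈)

  ≼-suffix : ∀ {x y} → y ≼ x → ∃ λ ws → rootPath x ≡ ws ++ rootPath y
  ≼-suffix {x} {y} y≼x with ∈-∃++ y≼x
  ... | ws , zs , eq = ws , trans eq (cong (λ tl → ws ++ y ∷ tl) zs≡)
    where
      zs≡ : zs ≡ rootTail y
      zs≡ = rootTail-unique zs (IsPath-++⁻ʳ ws (subst (IsPath E) eq (rootPath-isPath x)))
              (trans (sym (lastV-split ws y zs eq)) (rootPath-last x))

  ≼-trans : ∀ {x y w} → x ≼ y → y ≼ w → x ≼ w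
  ≼-trans x≼y y≼w with ≼-suffix y≼w
  ... | ws , eq = subst (_ ∈_) (sym eq) (∈-++⁺ʳ ws x≼y)

  ≼-chain : ∀ {x y w} → y ≼ x → w ≼ x → y ≼ w ⊎ w ≼ y
  ≼-chain y≼x w≼x with ≼-suffix y≼x | ≼-suffix w≼x
  ... | ws₁ , e₁ | ws₂ , e₂ with ++-suffix-total ws₁ ws₂ (trans (sym e₁) e₂)
  ... | inj₁ (vs , e) = inj₂ (subst (_ ∈_) (sym e) (∈-++⁺ʳ vs (here refl)))
  ... | inj₂ (vs , e) = inj₁ (subst (_ ∈_) (sym e) (∈-++⁺ʳ vs (here refl)))

  open TreeOrder _≼_ ≼-trans ≼-chain _≼?_ public

  child-⋠-parent : ∀ {p c} → Parent p c → ¬ c ≼ p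
  child-⋠-parent {p} {c} p↓c c≼p with ≼-suffix c≼p
  ... | ws , eq = ++-∷-≢ (rootPath p) ws (trans eq (cong (λ tl → ws ++ c ∷ tl) p↓c))

  parent-asym : ∀ {p c} → Parent p c → ¬ Parent c p
  parent-asym p↓c c↓p = child-⋠-parent c↓p (parent-≼ p↓c)

  siblings-unique : ∀ {p a b t} → Parent p a → Parent p b → a ≼ t → b ≼ t → a ≡ b
  siblings-unique {p} {a} {b} {t} p↓a p↓b a≼t b≼t with ≼-suffix a≼t | ≼-suffix b≼t
  ... | ws₁ , e₁ | ws₂ , e₂ = ++-∷-cancelʳ ws₁ ws₂ (rootPath p) (begin
    ws₁ ++ a ∷ rootPath p   ≡⟨ cong (λ tl → ws₁ ++ a ∷ tl) p↓a ⟨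
    ws₁ ++ rootPath a       ≡⟨ e₁ ⟨
    rootPath t              ≡⟨ e₂ ⟩
    ws₂ ++ rootPath b       ≡⟨ cong (λ tl → ws₂ ++ b ∷ tl) p↓b ⟩
    ws₂ ++ b ∷ rootPath p   ∎)
    where open ≡-Reasoning

  converging⇒parent : ∀ {u v} → ConvergingArc E z u v → Parent v u
  converging⇒parent {u} {v} (ys , p , e) =
    trans (sym (rootTail-unique (v ∷ ys) p e)) (cong (v ∷_) (rootTail-unique ys (IsPath-tail p) e))

  parent⇒converging : ∀ {u v} → Parent v u → ConvergingArc E z u v
  parent⇒converging {u} {v} v↓u =
    rootTail v , subst (λ tl → IsPath E (u ∷ tl)) v↓u (rootPath-isPath u) , rootPath-last v

  nonconverging⇒parent : ∀ {u v} → Arc E u v → ¬ ConvergingArc E z u v → Parent u v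
  nonconverging⇒parent {u} {v} uv nc = sym (rootTail-unique (rootPath u) detour (rootPath-last u))
    where
      v∉ : ∀ ys → IsPath E (u ∷ ys) → lastV E u ys ≡ z → v ∉ u ∷ ys
      v∉ _        _ _ (here v≡u)         = arc-irrefl (subst (Arc E u) v≡u uv)
      v∉ (c ∷ ys) p e (there (here refl)) = nc (ys , p , e)
      v∉ (c ∷ ys) p _ (there (there v∈))  = no-arc-back ys p v∈ (arc-sym uv)
      detour : IsPath E (v ∷ rootPath u)
      detour = arc-sym uv ∷ proj₁ (rootPath-isPath u)
             , ¬Any⇒All¬ _ (v∉ _ (rootPath-isPath u) (rootPath-last u)) ∷ proj₂ (rootPath-isPath u)

  arc-dichotomy : ∀ {u v} → Arc E u v → Parent v u ⊎ Parent u v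
  arc-dichotomy {u} {v} uv with ≡-dec _≟_ (rootTail u) (rootPath v)
  ... | yes v↓u = inj₁ v↓u
  ... | no ¬v↓u = inj₂ (nonconverging⇒parent uv (¬v↓u ∘ converging⇒parent))

  Ascends Descends : Fin n × Fin n → Set
  Ascends  e = Parent (proj₂ e) (proj₁ e)
  Descends e = Parent (proj₁ e) (proj₂ e)

  descent-continues : ∀ {u v w xs} → IsPath E (u ∷ v ∷ w ∷ xs) → Parent u v → Parent v w
  descent-continues p u↓v with arc-dichotomy (firstArc (IsPath-tail p))
  ... | inj₁ w↓v = ⊥-elim (IsPath-head-∉ p (there (here (parent-unique u↓v w↓v))))
  ... | inj₂ v↓w = v↓w

  descent-all : ∀ {u v} xs → IsPath E (u ∷ v ∷ xs) → Parent u v →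
                All Descends (arcs E (u ∷ v ∷ xs))
  descent-all []       _ u↓v = u↓v ∷ []
  descent-all (w ∷ xs) p u↓v = u↓v ∷ descent-all xs (IsPath-tail p) (descent-continues p u↓v)

  descent-reaches : ∀ {u v} xs → IsPath E (u ∷ v ∷ xs) → Parent u v → v ≼ lastV E v xs
  descent-reaches []       _ _   = here refl
  descent-reaches (w ∷ xs) p u↓v = ≼-trans (parent-≼ v↓w) (descent-reaches xs (IsPath-tail p) v↓w)
    where
      v↓w : Parent _ w
      v↓w = descent-continues p u↓v

  ascent-all : ∀ {u v} xs → IsPath E (u ∷ v ∷ xs) → Ascends (lastTwo E u v xs) →
               All Ascends (arcs E (u ∷ v ∷ xs))
  ascent-all []       _ last↑ = last↑ ∷ []
  ascent-all {u} {v} (w ∷ xs) p last↑ with arc-dichotomy (firstArc p)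
  ... | inj₁ v↓u = v↓u ∷ ascent-all xs (IsPath-tail p) last↑
  ... | inj₂ u↓v =
    ⊥-elim (parent-asym (All-arcs-last u v (w ∷ xs) (descent-all (w ∷ xs) p u↓v)) last↑)

  ascent-penult-≼ : ∀ u v xs → All Ascends (arcs E (u ∷ v ∷ xs)) → penult u v xs ≼ u
  ascent-penult-≼ u v []       _           = here refl
  ascent-penult-≼ u v (w ∷ xs) (v↓u ∷ ups) = ≼-trans (ascent-penult-≼ v w xs ups) (parent-≼ v↓u)

  last-ascends⇒penult-≼ : ∀ {u v} xs → IsPath E (u ∷ v ∷ xs) → Ascends (lastTwo E u v xs) →
                          penult u v xs ≼ u
  last-ascends⇒penult-≼ xs p last↑ = ascent-penult-≼ _ _ xs (ascent-all xs p last↑)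

  off-path-⋠ : ∀ {a v} xs → IsPath E (v ∷ xs) → a ∉ v ∷ xs → ¬ a ≼ v → ¬ a ≼ lastV E v xs
  off-path-⋠ []       _ _  a⋠v = a⋠v
  off-path-⋠ (c ∷ xs) p a∉ a⋠v with arc-dichotomy (firstArc p)
  ... | inj₁ c↓v =
    off-path-⋠ xs (IsPath-tail p) (a∉ ∘ there) (λ a≼c → a⋠v (≼-trans a≼c (parent-≼ c↓v)))
  ... | inj₂ v↓c = off-path-⋠ xs (IsPath-tail p) (a∉ ∘ there) a⋠c
    where
      a⋠c : ¬ _ ≼ c
      a⋠c a≼c with ≼-of-child v↓c a≼c
      ... | inj₁ a≡c = a∉ (there (here a≡c))
      ... | inj₂ a≼v = a⋠v a≼v

  ascent-start-⋠ : ∀ {u v} xs → IsPath E (u ∷ v ∷ xs) → Parent v u → ¬ u ≼ lastV E v xs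
  ascent-start-⋠ xs p v↓u = off-path-⋠ xs (IsPath-tail p) (IsPath-head-∉ p) (child-⋠-parent v↓u)

  descent-end-⋠ : ∀ u v xs → IsPath E (u ∷ v ∷ xs) → Descends (lastTwo E u v xs) →
                  ¬ ult u v xs ≼ u
  descent-end-⋠ u v []       _ u↓v = child-⋠-parent u↓v
  descent-end-⋠ u v (w ∷ xs) p last↓ t≼u with arc-dichotomy (firstArc p)
  ... | inj₂ u↓v = descent-end-⋠ v w xs (IsPath-tail p) last↓ (≼-trans t≼u (parent-≼ u↓v))
  ... | inj₁ v↓u with ≼-of-child v↓u t≼u
  ...   | inj₂ t≼v = descent-end-⋠ v w xs (IsPath-tail p) last↓ t≼v
  ...   | inj₁ t≡u = IsPath-head-∉ p (subst (_∈ v ∷ w ∷ xs) t≡u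
                       (subst (_∈ v ∷ w ∷ xs) (sym (ult≡lastV v w xs)) (there (lastV-∈ w xs))))

  -- FirstArc s c t says that (s , c) is the first arc of T[s,t] (see second-unique),
  -- LastArc q t s that (q , t) is its last arc (see penult-unique).
  FirstArc : Fin n → Fin n → Fin n → Set
  FirstArc s c t = (Parent c s × ¬ s ≼ t) ⊎ (Parent s c × c ≼ t)

  LastArc : Fin n → Fin n → Fin n → Set
  LastArc q t s = (Parent q t × ¬ t ≼ s) ⊎ (Parent t q × q ≼ s)

  second-unique : ∀ {s w c} xs → IsPath E (s ∷ w ∷ xs) → FirstArc s c (lastV E w xs) → w ≡ c
  second-unique xs p first with arc-dichotomy (firstArc p) | first
  ... | inj₁ w↓s | inj₁ (c↓s , _)   = parent-unique w↓s c↓s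
  ... | inj₁ w↓s | inj₂ (s↓c , c≼t) =
    ⊥-elim (ascent-start-⋠ xs p w↓s (≼-trans (parent-≼ s↓c) c≼t))
  ... | inj₂ s↓w | inj₁ (_ , s⋠t)   =
    ⊥-elim (s⋠t (≼-trans (parent-≼ s↓w) (descent-reaches xs p s↓w)))
  ... | inj₂ s↓w | inj₂ (s↓c , c≼t) = siblings-unique s↓w s↓c (descent-reaches xs p s↓w) c≼t

  penult-unique : ∀ {s w q} xs → IsPath E (s ∷ w ∷ xs) → LastArc q (ult s w xs) s →
                  penult s w xs ≡ q
  penult-unique {s} {w} xs p last with arc-dichotomy (lastArc xs p) | last
  ... | inj₁ t↓pen | inj₁ (_ , t⋠s)   =
    ⊥-elim (t⋠s (≼-trans (parent-≼ t↓pen) (last-ascends⇒penult-≼ xs p t↓pen)))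
  ... | inj₁ t↓pen | inj₂ (t↓q , q≼s) = siblings-unique t↓pen t↓q (last-ascends⇒penult-≼ xs p t↓pen) q≼s
  ... | inj₂ pen↓t | inj₁ (q↓t , _)   = parent-unique pen↓t q↓t
  ... | inj₂ pen↓t | inj₂ (t↓q , q≼s) =
    ⊥-elim (descent-end-⋠ s w xs p pen↓t (≼-trans (parent-≼ t↓q) q≼s))

  FirstArc-self-⊥ : ∀ {s c} → ¬ FirstArc s c s
  FirstArc-self-⊥ (inj₁ (_ , s⋠s))   = s⋠s (here refl)
  FirstArc-self-⊥ (inj₂ (s↓c , c≼s)) = child-⋠-parent s↓c c≼s

  interferesOn : ∀ r r' → FirstArc (src r) (snd r) (tgt r') → LastArc (pen r') (tgt r') (src r) →
                 InterferesOn E r r'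
  interferesOn r r' first last with connected (src r) (tgt r')
  ... | []     , _ , s≡t = ⊥-elim (FirstArc-self-⊥ (subst (FirstArc _ _) (sym s≡t) first))
  ... | w ∷ xs , p , e with second-unique xs p (subst (FirstArc _ _) (sym e) first)
  ... | refl =
    xs , p , cong₂ _,_ (penult-unique xs p (subst (λ t → LastArc _ t _) (sym ult≡t) last)) ult≡t
    where
      ult≡t : ult (src r) (snd r) xs ≡ tgt r'
      ult≡t = trans (ult≡lastV _ _ xs) e

  interferesOn-∥ : ∀ r r' → Parent (snd r) (src r) → Parent (pen r') (tgt r') →
                   ¬ Comparable (src r) (tgt r') → InterferesOn E r r'
  interferesOn-∥ r r' first↑ last↓ s∥t =
    interferesOn r r' (inj₁ (first↑ , s∥t ∘ inj₁)) (inj₁ (last↓ , s∥t ∘ inj₂))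

  interferesOn-ascending : ∀ r r' → Parent (snd r) (src r) → Parent (tgt r') (pen r') →
                           pen r' ≼ src r → InterferesOn E r r'
  interferesOn-ascending r r' first↑ last↑ q≼s =
    interferesOn r r' (inj₁ (first↑ , λ s≼t → child-⋠-parent last↑ (≼-trans q≼s s≼t)))
                      (inj₂ (last↑ , q≼s))

  interferesOn-descending : ∀ r r' → Parent (src r) (snd r) → Parent (pen r') (tgt r') →
                            snd r ≼ tgt r' → InterferesOn E r r'
  interferesOn-descending r r' first↓ last↓ c≼t =
    interferesOn r r' (inj₂ (first↓ , c≼t))
                      (inj₁ (last↓ , λ t≼s → child-⋠-parent first↓ (≼-trans c≼t t≼s)))

  converging-first : ∀ r → ConvergingReq E z r → Parent (snd r) (src r)
  converging-first _ (first ∷ _) = converging⇒parent first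

  converging-last : ∀ r → ConvergingReq E z r → Parent (tgt r) (pen r)
  converging-last r conv = converging⇒parent (All-arcs-last (src r) (snd r) (rest r) conv)

  converging-pen-≼ : ∀ r → ConvergingReq E z r → pen r ≼ src r
  converging-pen-≼ r conv = ascent-penult-≼ (src r) (snd r) (rest r) (All.map converging⇒parent conv)

  diverging-first : ∀ r → DivergingReq E z r → Parent (src r) (snd r)
  diverging-first r (first ∷ _) = nonconverging⇒parent (firstArc (isPath r)) first

  diverging-last : ∀ r → DivergingReq E z r → Parent (pen r) (tgt r)
  diverging-last r div =
    nonconverging⇒parent (lastArc (rest r) (isPath r)) (All-arcs-last (src r) (snd r) (rest r) div)

  diverging-snd-≼ : ∀ r → DivergingReq E z r → snd r ≼ tgt r
  diverging-snd-≼ r div = subst (snd r ≼_) (sym (ult≡lastV (src r) (snd r) (rest r)))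
                              (descent-reaches (rest r) (isPath r) (diverging-first r div))

  unimodal-first : ∀ r → UnimodalReq E z r → Parent (snd r) (src r)
  unimodal-first r (_ , ¬div) with arc-dichotomy (firstArc (isPath r))
  ... | inj₁ first↑ = first↑
  ... | inj₂ first↓ = ⊥-elim (¬div (All.map (λ a↓b conv → parent-asym a↓b (converging⇒parent conv))
                                            (descent-all (rest r) (isPath r) first↓)))

  unimodal-last : ∀ r → UnimodalReq E z r → Parent (pen r) (tgt r)
  unimodal-last r (¬conv , _) with arc-dichotomy (lastArc (rest r) (isPath r))
  ... | inj₁ last↑ = ⊥-elim (¬conv (All.map parent⇒converging (ascent-all (rest r) (isPath r) last↑)))
  ... | inj₂ last↓ = last↓

  unimodal-ends-∥ : ∀ r → UnimodalReq E z r → ¬ Comparable (src r) (tgt r)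
  unimodal-ends-∥ r uni (inj₁ s≼t) = ascent-start-⋠ (rest r) (isPath r) (unimodal-first r uni)
                                         (subst (src r ≼_) (ult≡lastV (src r) (snd r) (rest r)) s≼t)
  unimodal-ends-∥ r uni (inj₂ t≼s) =
    descent-end-⋠ (src r) (snd r) (rest r) (isPath r) (unimodal-last r uni) t≼s

lemma5 : ∀ {n : ℕ} (E : Graph n) → IsTree E → (z : Fin n) →
         (r⁻ r⁺ r∨ : Request E) →
         ConvergingReq E z r⁻ → DivergingReq E z r⁺ → UnimodalReq E z r∨ →
         Interfere E r⁻ r⁺ ⊎ (Interfere E r⁻ r∨ ⊎ Interfere E r⁺ r∨)
lemma5 E tree z r⁻ r⁺ r∨ conv div uni =
  case ∥-split (unimodal-ends-∥ r∨ uni) (src r⁻) (tgt r⁺) of λ where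
    (inj₁ s⁻∥t∨) →
      inj₂ (inj₁ (inj₁ (interferesOn-∥ r⁻ r∨ (converging-first r⁻ conv) (unimodal-last r∨ uni) s⁻∥t∨)))
    (inj₂ (inj₁ s⁻∥t⁺)) →
      inj₁ (inj₁ (interferesOn-∥ r⁻ r⁺ (converging-first r⁻ conv) (diverging-last r⁺ div) s⁻∥t⁺))
    (inj₂ (inj₂ (inj₁ s∨∥t⁺))) →
      inj₂ (inj₂ (inj₂ (interferesOn-∥ r∨ r⁺ (unimodal-first r∨ uni) (diverging-last r⁺ div) s∨∥t⁺)))
    (inj₂ (inj₂ (inj₂ (inj₁ s⁻≼s∨)))) →
      inj₂ (inj₁ (inj₂ (interferesOn-ascending r∨ r⁻ (unimodal-first r∨ uni) (converging-last r⁻ conv)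
                          (≼-trans (converging-pen-≼ r⁻ conv) s⁻≼s∨))))
    (inj₂ (inj₂ (inj₂ (inj₂ t⁺≼t∨)))) →
      inj₂ (inj₂ (inj₁ (interferesOn-descending r⁺ r∨ (diverging-first r⁺ div) (unimodal-last r∨ uni)
                          (≼-trans (diverging-snd-≼ r⁺ div) t⁺≼t∨))))
  where open Rooted tree z
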